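{- Let $\mathcal{A}=(Q,E,s,F)$ be a Wheeler $r$-GNFA (possibly with $\epsilon$-transitions), let $\le$ be a Wheeler order on $\mathcal{A}$, and let $\alpha\in\Sigma^*$ with $\alpha\neq\epsilon$. For $0<k<\min\{r+1,|\alpha|\}$ let $f_k=\mathtt{out}(Q[1,|G^\prec(p(\alpha,|\alpha|-k))|],s(\alpha,k))$ and $g_k=\mathtt{out}(Q[1,|G^\prec_\dashv(p(\alpha,|\alpha|-k))|],s(\alpha,k))$. Then $g_k\ge f_k$ for every $0<k<\min\{r+1,|\alpha|\}$. Let $h^*$ be the maximum among: (a) $|G^\prec(\alpha)|$; (b) the largest integer $0\le i\le|Q|$ such that, if $i\ge1$, then $Q[i]\in G^*(\alpha)$; (c) the smallest integer $0\le j\le|Q|$ such that, for every $0<k<\min\{r+1,|\alpha|\}$ with $g_k>f_k$, we have $\mathtt{in}(Q[1,j],s(\alpha,k))\ge g_k$. Then $h^*\ge|G^\prec(\alpha)|$. Moreover: if $h^*=|G^\prec(\alpha)|$, then $|G^\prec_\dashv(\alpha)|=h^*=|G^\prec(\alpha)|$; and if $h^*>|G^\prec(\alpha)|$, then $|G^\prec_\dashv(\alpha)|\ge h^*>|G^\prec(\alpha)|$ and $|G^\prec_\dashv(\alpha)|$ is the smallest integer $h^*\le t\le|Q|$ such that, if $t<|Q|$, then $A_{\min}[t+1]=t+1$.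
   Context: $\Sigma$ is a finite alphabet with a fixed total order $\preceq$, extended co-lexicographically to $\Sigma^*$ (compare reversed strings lexicographically); $\epsilon$ is the empty string; $\alpha\dashv\beta$ means $\alpha$ is a suffix of $\beta$; $p(\alpha,k)$ and $s(\alpha,k)$ denote the prefix and suffix of $\alpha$ of length $k$. A GNFA is $\mathcal{A}=(Q,E,s,F)$ with finite state set $Q$, finite edge set $E\subseteq Q\times Q\times\Sigma^*$ (labels may be $\epsilon$), initial state $s$, final states $F$; every state is reachable from $s$ and is final or can reach a final state. It is an $r$-GNFA if every label has length at most $r$. $I_u$ is the set of strings $\alpha_1\cdots\alpha_{t-1}$ with states $u_1=s,\dots,u_t=u$ ($t\ge1$), $(u_i,u_{i+1},\alpha_i)\in E$. $u\preceq_{\mathcal{A}}v$ iff for all $\alpha\in I_u,\beta\in I_v$ with $\{\alpha,\beta\}\not\subseteq I_u\cap I_v$, $\alpha\prec\beta$. A Wheeler order is a total order $\le$ on $Q$ with: (1) $u\le v\Rightarrow u\preceq_{\mathcal{A}}v$; (2) $s$ is $\le$-minimum; (3) for $(u',u,\rho),(v',v,\rho')\in E$, if $u<v$ and $\rho'$ is not a strict suffix of $\rho$ then $\rho\preceq\rho'$; (4) for $(u',u,\rho),(v',v,\rho)\in E$, $u<v\Rightarrow u'\le v'$. Write $Q[1]<\dots<Q[|Q|]$ for the states in order, $Q[i,j]=\{Q[i],\dots,Q[j]\}$ ($\emptyset$ if $i>j$). For $U\subseteq Q$ and $\rho\in\Sigma^*$, $\mathtt{out}(U,\rho)$ (resp.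 $\mathtt{in}(U,\rho)$) is the number of edges labeled $\rho$ leaving (resp. entering) states of $U$. $\lambda(u)$ is the set of labels of edges entering $u$. $G^\prec(\alpha)=\{u:\forall\beta\in I_u,\ \beta\prec\alpha\}$, $G_\dashv(\alpha)=\{u:\exists\beta\in I_u,\ \alpha\dashv\beta\}$, $G^\prec_\dashv(\alpha)=G^\prec(\alpha)\cup G_\dashv(\alpha)$, $G^*(\alpha)=\{u\in Q:\exists\rho\in\lambda(u),\ \alpha\dashv\rho\}$. An $\epsilon$-walk from $u$ to $v$ is a sequence $z_1=u,\dots,z_t=v$ ($t\ge1$) with $(z_i,z_{i+1},\epsilon)\in E$. $A_{\min}[i]$ is the smallest $1\le j\le|Q|$ such that there is an $\epsilon$-walk from $Q[j]$ to $Q[i]$. -}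

module Defs where

open import Data.Nat as ℕ using (ℕ; zero; suc; _≤_; _<_; _≤?_; _∸_; _⊔_; _⊓_)
open import Data.Fin as Fin using (Fin; toℕ)
open import Data.Fin.Subset using (Subset; _∈_; ∣_∣)
open import Data.List using (List; []; _∷_; _++_; reverse; length; filter; take; drop)
open import Data.List.Properties using (≡-dec)
open import Data.List.Membership.Propositional renaming (_∈_ to _∈L_)
open import Data.List.Relation.Unary.All using (All)
open import Data.List.Relation.Unary.Unique.Propositional using (Unique)
open import Data.Product using (Σ; ∃; ∃-syntax; _×_; _,_; proj₁; proj₂)
open import Data.Sum using (_⊎_)
open import Function.Bundles using (_↔_; Inverse)
open import Relation.Binary.PropositionalEquality using (_≡_; _≢_)
open import Relation.Nullary using (¬_)
open import Relation.Nullary.Decidable using (_×-dec_)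

Word : ℕ → Set
Word σ = List (Fin σ)

data _<lex_ {σ : ℕ} : Word σ → Word σ → Set where
  []<∷   : ∀ {y ys} → [] <lex (y ∷ ys)
  head<  : ∀ {x y xs ys} → x Fin.< y → (x ∷ xs) <lex (y ∷ ys)
  tail<  : ∀ {x xs ys} → xs <lex ys → (x ∷ xs) <lex (x ∷ ys)

_≺_ : ∀ {σ} → Word σ → Word σ → Set
α ≺ β = reverse α <lex reverse β

_⪯_ : ∀ {σ} → Word σ → Word σ → Set
α ⪯ β = α ≺ β ⊎ α ≡ β

_⊣_ : ∀ {σ} → Word σ → Word σ → Set
α ⊣ β = ∃[ γ ] (γ ++ α ≡ β)

StrictSuffix : ∀ {σ} → Word σ → Word σ → Set
StrictSuffix α β = α ⊣ β × α ≢ β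

pre : ∀ {σ} → Word σ → ℕ → Word σ
pre α k = take k α

suf : ∀ {σ} → Word σ → ℕ → Word σ
suf α k = drop (length α ∸ k) α

Edge : ℕ → ℕ → Set
Edge σ n = Fin n × Fin n × Word σ

src : ∀ {σ n} → Edge σ n → Fin n
src (u , v , ρ) = u

tgt : ∀ {σ n} → Edge σ n → Fin n
tgt (u , v , ρ) = v

lab : ∀ {σ n} → Edge σ n → Word σ
lab (u , v , ρ) = ρ

record GNFA (σ n : ℕ) : Set where
  field
    E : List (Edge σ n)
    s : Fin n
    F : Subset n

module _ {σ n : ℕ} (A : GNFA σ n) where
  open GNFA A

  data Reach : Fin n → Fin n → Set where
    here  : ∀ {u} → Reach u u
    step  : ∀ {u v w ρ} → (u , v , ρ) ∈L E → Reach v w → Reach u w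

  -- the standing well-formedness assumptions: E is a set (no repeated
  -- edges), every state reachable from s and final or co-reachable.
  IsGNFA : Set
  IsGNFA = Unique E
         × (∀ u → Reach s u)
         × (∀ u → ∃[ f ] (f ∈ F × Reach u f))

  IsRGNFA : ℕ → Set
  IsRGNFA r = All (λ e → length (lab e) ≤ r) E

  data I : Fin n → Word σ → Set where
    start : I s []
    next  : ∀ {u' u β ρ} → I u' β → (u' , u , ρ) ∈L E → I u (β ++ ρ)

  _⪯A_ : Fin n → Fin n → Set
  u ⪯A v = ∀ α β → I u α → I v β →
           ¬ ((I u α × I v α) × (I u β × I v β)) → α ≺ β

  data EpsWalk : Fin n → Fin n → Set where
    done : ∀ {u} → EpsWalk u u
    more : ∀ {u v w} → (u , v , []) ∈L E → EpsWalk v w → EpsWalk u w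

  Gprec : Word σ → Fin n → Set
  Gprec α u = ∀ β → I u β → β ≺ α

  Gsuf : Word σ → Fin n → Set
  Gsuf α u = ∃[ β ] (I u β × α ⊣ β)

  GprecSuf : Word σ → Fin n → Set
  GprecSuf α u = Gprec α u ⊎ Gsuf α u

  Gstar : Word σ → Fin n → Set
  Gstar α u = ∃[ u' ] ∃[ ρ ] ((u' , u , ρ) ∈L E × α ⊣ ρ)

  -- A total order on Q is given by an enumeration Q[1] < ... < Q[n]:
  -- ord : Fin n ↔ Fin n, with Q[i] = to ord (i-1). rank u ∈ {1..n} is
  -- the 1-based position of u.
  module Ordered (ord : Fin n ↔ Fin n) where
    rank : Fin n → ℕ
    rank u = suc (toℕ (Inverse.from ord u))

    _≤Q_ : Fin n → Fin n → Set
    u ≤Q v = rank u ≤ rank v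

    _<Q_ : Fin n → Fin n → Set
    u <Q v = rank u < rank v

    -- Wheeler order conditions (1)-(4)
    IsWheelerOrder : Set
    IsWheelerOrder =
        (∀ u v → u ≤Q v → u ⪯A v)
      × (∀ u → s ≤Q u)
      × (∀ u' u ρ v' v ρ' → (u' , u , ρ) ∈L E → (v' , v , ρ') ∈L E →
           u <Q v → ¬ StrictSuffix ρ' ρ → ρ ⪯ ρ')
      × (∀ u' u v' v ρ → (u' , u , ρ) ∈L E → (v' , v , ρ) ∈L E →
           u <Q v → u' ≤Q v')

    out : ℕ → Word σ → ℕ
    out j ρ = length (filter (λ e → (rank (src e) ≤? j) ×-dec (≡-dec Fin._≟_ (lab e) ρ)) E)

    inn : ℕ → Word σ → ℕ
    inn j ρ = length (filter (λ e → (rank (tgt e) ≤? j) ×-dec (≡-dec Fin._≟_ (lab e) ρ)) E)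

    At : ℕ → (Fin n → Set) → Set
    At i P = ∃[ u ] (rank u ≡ i × P u)

    AminIs : ℕ → ℕ → Set
    AminIs i v =
        (1 ≤ v × v ≤ n × ∃[ x ] ∃[ y ] (rank x ≡ v × rank y ≡ i × EpsWalk x y))
      × (∀ j → 1 ≤ j → j ≤ n →
           ∃[ x ] ∃[ y ] (rank x ≡ j × rank y ≡ i × EpsWalk x y) → v ≤ j)

-- Cardinality of a subset of Fin n given by a predicate: S represents P.

Represents : ∀ {n} → Subset n → (Fin n → Set) → Set
Represents S P = ∀ u → (u ∈ S → P u) × (P u → u ∈ S)

IsLargest : (ℕ → Set) → ℕ → Set
IsLargest P m = P m × (∀ i → P i → i ≤ m)

IsSmallest : (ℕ → Set) → ℕ → Set
IsSmallest P m = P m × (∀ i → P i → m ≤ i)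

{-# OPTIONS --safe #-}
module Submission where

-- In a Wheeler order G^≺(α) and G^≺_⊣(α) are downward closed (axiom (1)), so they are the prefixes
-- Q[1,a] and Q[1,d] with a = |G^≺(α)|, d = |G^≺_⊣(α)|, and Q[a+1,d] is G_⊣(α). Following a string
-- with suffix α back to the edge on which α begins shows that every state of G_⊣(α) is ε-reachable
-- from a state of G_⊣(α) that is entered either by a label with suffix α, hence lies at position
-- ≤ (b), or by an edge labelled s(α,k) from G_⊣(p(α,|α|-k)), hence lies at position ≤ (c), as
-- otherwise axiom (4) gives in(Q[1,(c)], s(α,k)) < g_k. So every state of G_⊣(α) has an ε-ancestor
-- in G_⊣(α) at position ≤ h*. If h* = a this forces G_⊣(α) = ∅. If h* > a it rules out
-- A_min[t+1] = t+1 for h* ≤ t < d, while Q[d+1] has no ε-ancestor in G^≺_⊣(α) at all, because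
-- axiom (1) places its strings above those of Q[a+1], which end in α.

open import Defs
open import Data.Nat using (ℕ; zero; suc; _≤_; _<_; _∸_; _⊔_; _⊓_)
open import Data.Fin using (Fin)
open import Data.Fin.Subset using (Subset; ∣_∣)
open import Data.List using (List; []; length)
open import Data.Product using (_×_)
open import Function.Bundles using (_↔_)
open import Relation.Binary.PropositionalEquality using (_≡_; _≢_)

open import Data.Nat.Base using (z≤n; s≤s; s≤s⁻¹)
open import Data.Nat.Properties
  using (_≤?_; +-0-commutativeMonoid; ≤-refl; ≤-trans; ≤-antisym; ≤-<-trans; <-≤-trans; <-trans; <-irrefl; <⇒≤;
         ≰⇒>; ≮⇒≥; <⇒≱; n≮0; 1+n≰n; m≤n⇒m≤1+n; m<n⇒m<1+n; m≤m⊔n; m≤n⊔m; ⊔-lub; ⊓-glb; m+n∸n≡m)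
open import Data.Fin as Fin using (toℕ; fromℕ<)
open import Data.Fin.Properties using (toℕ<n; toℕ-fromℕ<)
open import Data.Fin.Subset using (Side; inside; outside; _∈_)
open import Data.Fin.Subset.Properties using (_∈?_; p⊆q⇒∣p∣≤∣q∣; ∣p∣≤n)
open import Data.Vec using ([]; _∷_; lookup)
open import Data.Vec.Properties using ([]=⇒lookup; lookup⇒[]=)
open import Data.List using (_∷_; _++_; reverse; take; drop; filter)
open import Data.List.Properties
  using (∷-injective; ++-assoc; ++-conicalʳ; ++-identityʳ; length-++; length-++-≤ʳ;
         reverse-++; reverse-involutive; take++drop≡id; take-all)
open import Data.List.Membership.Propositional using (find; lose) renaming (_∈_ to _∈L_)
open import Data.List.Relation.Unary.Any using (here; there; any?)
open import Data.List.Relation.Unary.All as All using ()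
open import Data.Product using (∃-syntax; _,_; proj₁; proj₂)
open import Data.Sum using (_⊎_; inj₁; inj₂; [_,_]; map₂)
open import Function using (_∘_; id)
open import Function.Bundles using (_⇔_; mk⇔; Equivalence; Inverse)
open import Relation.Binary.PropositionalEquality using (refl; sym; trans; cong; subst; subst₂; module ≡-Reasoning)
open import Relation.Nullary using (¬_; Dec; yes; no; contradiction; ¬?)
open import Relation.Nullary.Decidable using (_×-dec_)
open import Relation.Unary using (Pred; Decidable)
open import Algebra.Properties.CommutativeMonoid.Sum +-0-commutativeMonoid using (sum; sum-permute; sum-cong-≗; sum-replicate-zero)

open Equivalence using (to; from)

indicator : Side → ℕ
indicator inside  = 1
indicator outside = 0

∣p∣≡∑indicator : ∀ {n} (p : Subset n) → ∣ p ∣ ≡ sum (indicator ∘ lookup p)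
∣p∣≡∑indicator []            = refl
∣p∣≡∑indicator (inside ∷ p)  = cong suc (∣p∣≡∑indicator p)
∣p∣≡∑indicator (outside ∷ p) = ∣p∣≡∑indicator p

inside⇔<∑indicator : ∀ {n} (h : Fin n → Side) →
                     (∀ {i j} → i Fin.≤ j → h j ≡ inside → h i ≡ inside) →
                     ∀ i → h i ≡ inside ⇔ toℕ i < sum (indicator ∘ h)
inside⇔<∑indicator {suc n} h closed i with h Fin.zero in h₀
... | outside = mk⇔ (λ hᵢ → contradiction (trans (sym h₀) (closed z≤n hᵢ)) λ ())
                    (λ i<∑ → contradiction (subst (toℕ i <_) ∑≡0 i<∑) n≮0)
  where
    outside-everywhere : ∀ j → indicator (h (Fin.suc j)) ≡ 0
    outside-everywhere j with h (Fin.suc j) in hⱼ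
    ... | outside = refl
    ... | inside  = contradiction (trans (sym h₀) (closed z≤n hⱼ)) λ ()
    ∑≡0 : sum (indicator ∘ h ∘ Fin.suc) ≡ 0
    ∑≡0 = trans (sum-cong-≗ outside-everywhere) (sum-replicate-zero n)
inside⇔<∑indicator {suc n} h closed Fin.zero    | inside = mk⇔ (λ _ → s≤s z≤n) (λ _ → h₀)
inside⇔<∑indicator {suc n} h closed (Fin.suc i) | inside = mk⇔ (s≤s ∘ to ih) (from ih ∘ s≤s⁻¹)
  where
    ih : h (Fin.suc i) ≡ inside ⇔ toℕ i < sum (indicator ∘ h ∘ Fin.suc)
    ih = inside⇔<∑indicator (h ∘ Fin.suc) (closed ∘ s≤s) i

module _ {n : ℕ} (ord : Fin n ↔ Fin n) where

  position : Fin n → ℕ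
  position u = suc (toℕ (Inverse.from ord u))

  position≤n : ∀ u → position u ≤ n
  position≤n u = toℕ<n (Inverse.from ord u)

  position-onto : ∀ {t} → t < n → ∃[ u ] position u ≡ suc t
  position-onto t<n = Inverse.to ord i , cong suc (trans (cong toℕ (Inverse.strictlyInverseʳ ord i)) (toℕ-fromℕ< t<n))
    where
      i : Fin n
      i = fromℕ< t<n

  ∈⇔position≤∣∣ : (S : Subset n) → (∀ {u v} → position u ≤ position v → v ∈ S → u ∈ S) →
                  ∀ u → u ∈ S ⇔ position u ≤ ∣ S ∣
  ∈⇔position≤∣∣ S closed u = mk⇔
    (λ u∈S → subst (position u ≤_) (sym ∣S∣≡∑) (to prefix (trans (cong (lookup S) u↦u) ([]=⇒lookup u∈S))))
    (λ u≤∣S∣ → subst (_∈ S) u↦u (lookup⇒[]= _ S (from prefix (subst (position u ≤_) ∣S∣≡∑ u≤∣S∣))))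
    where
      h : Fin n → Side
      h = lookup S ∘ Inverse.to ord
      u↦u : Inverse.to ord (Inverse.from ord u) ≡ u
      u↦u = Inverse.strictlyInverseˡ ord u
      position-to : ∀ i → position (Inverse.to ord i) ≡ suc (toℕ i)
      position-to i = cong (suc ∘ toℕ) (Inverse.strictlyInverseʳ ord i)
      h-closed : ∀ {i j} → i Fin.≤ j → h j ≡ inside → h i ≡ inside
      h-closed {i} {j} i≤j hⱼ = []=⇒lookup (closed (subst₂ _≤_ (sym (position-to i)) (sym (position-to j)) (s≤s i≤j))
                                                    (lookup⇒[]= _ S hⱼ))
      ∣S∣≡∑ : ∣ S ∣ ≡ sum (indicator ∘ h)
      ∣S∣≡∑ = trans (∣p∣≡∑indicator S) (sum-permute (indicator ∘ lookup S) ord)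
      prefix : h (Inverse.from ord u) ≡ inside ⇔ toℕ (Inverse.from ord u) < sum (indicator ∘ h)
      prefix = inside⇔<∑indicator h h-closed (Inverse.from ord u)

  represented⇔position≤∣∣ : ∀ {P : Fin n → Set} (S : Subset n) → Represents S P →
                            (∀ {u v} → position u ≤ position v → P v → ¬ ¬ P u) →
                            ∀ u → P u ⇔ position u ≤ ∣ S ∣
  represented⇔position≤∣∣ {P} S rep downward u = mk⇔
    (to (∈⇔position≤∣∣ S closed u) ∘ proj₂ (rep u))
    (proj₁ (rep u) ∘ from (∈⇔position≤∣∣ S closed u))
    where
      closed : ∀ {u v} → position u ≤ position v → v ∈ S → u ∈ S
      closed {w} w≤v v∈S with w ∈? S
      ... | yes w∈S = w∈S
      ... | no  w∉S = contradiction (w∉S ∘ proj₂ (rep w)) (downward w≤v (proj₁ (rep _) v∈S))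

module _ {a p q} {A : Set a} {P : Pred A p} {Q : Pred A q} (P? : Decidable P) (Q? : Decidable Q) where

  filter-length-mono : ∀ xs → (∀ x → x ∈L xs → P x → Q x) →
                       length (filter P? xs) ≤ length (filter Q? xs)
  filter-length-mono []       P⇒Q = z≤n
  filter-length-mono (x ∷ xs) P⇒Q with P? x | Q? x | filter-length-mono xs (λ y → P⇒Q y ∘ there)
  ... | yes _  | yes _  | ih = s≤s ih
  ... | yes Px | no ¬Qx | _  = contradiction (P⇒Q x (here refl) Px) ¬Qx
  ... | no _   | yes _  | ih = m≤n⇒m≤1+n ih
  ... | no _   | no _   | ih = ih

  filter-length-mono-< : ∀ xs {y} → (∀ x → x ∈L xs → P x → Q x) → y ∈L xs → Q y → ¬ P y →
                         length (filter P? xs) < length (filter Q? xs)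
  filter-length-mono-< (x ∷ xs) P⇒Q (here refl) Qy ¬Py with P? x | Q? x
  ... | yes Py | _      = contradiction Py ¬Py
  ... | no _   | yes _  = s≤s (filter-length-mono xs (λ z → P⇒Q z ∘ there))
  ... | no _   | no ¬Qy = contradiction Qy ¬Qy
  filter-length-mono-< (x ∷ xs) P⇒Q (there y∈xs) Qy ¬Py
    with P? x | Q? x | filter-length-mono-< xs (λ z → P⇒Q z ∘ there) y∈xs Qy ¬Py
  ... | yes _  | yes _  | ih = s≤s ih
  ... | yes Px | no ¬Qx | _  = contradiction (P⇒Q x (here refl) Px) ¬Qx
  ... | no _   | yes _  | ih = m<n⇒m<1+n ih
  ... | no _   | no _   | ih = ih

module _ {a p q} {A : Set a} {P : Pred A p} {Q : Pred A q} (P? : Decidable P) (Q? : Decidable Q) where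

  filter-length-<⇒∃ : ∀ xs → length (filter P? xs) < length (filter Q? xs) →
                      ∃[ x ] (x ∈L xs × Q x × ¬ P x)
  filter-length-<⇒∃ xs P<Q with any? (λ x → Q? x ×-dec ¬? (P? x)) xs
  ... | yes witness = find witness
  ... | no  none    = contradiction (filter-length-mono Q? P? xs Q⇒P) (<⇒≱ P<Q)
    where
      Q⇒P : ∀ x → x ∈L xs → Q x → P x
      Q⇒P x x∈xs Qx with P? x
      ... | yes Px = Px
      ... | no ¬Px = contradiction (lose x∈xs (Qx , ¬Px)) none

module _ {σ : ℕ} where

  <lex-trans : {α β γ : Word σ} → α <lex β → β <lex γ → α <lex γ
  <lex-trans []<∷        (head< _)  = []<∷
  <lex-trans []<∷        (tail< _)  = []<∷
  <lex-trans (head< x<y) (head< y<z) = head< (<-trans x<y y<z)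
  <lex-trans (head< x<y) (tail< _)   = head< x<y
  <lex-trans (tail< _)   (head< y<z) = head< y<z
  <lex-trans (tail< p)   (tail< q)   = tail< (<lex-trans p q)

  <lex-dec : (α β : Word σ) → Dec (α <lex β)
  <lex-dec []      []      = no λ ()
  <lex-dec []      (_ ∷ _) = yes []<∷
  <lex-dec (_ ∷ _) []      = no λ ()
  <lex-dec (x ∷ α) (y ∷ β) with x Fin.<? y
  ... | yes x<y = yes (head< x<y)
  ... | no  x≮y with x Fin.≟ y
  ...   | no x≢y = no λ { (head< x<y) → x≮y x<y ; (tail< _) → x≢y refl }
  ...   | yes refl with <lex-dec α β
  ...     | yes α<β = yes (tail< α<β)
  ...     | no  α≮β = no λ { (head< x<x) → x≮y x<x ; (tail< α<β) → α≮β α<β }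

  ++≮lex : (α γ : Word σ) → ¬ (α ++ γ) <lex α
  ++≮lex (x ∷ α) γ (head< x<x) = <-irrefl refl x<x
  ++≮lex (x ∷ α) γ (tail< p)   = ++≮lex α γ p

  <lex-++-cases : (β α γ : Word σ) → β <lex (α ++ γ) → β <lex α ⊎ ∃[ δ ] β ≡ α ++ δ
  <lex-++-cases β       []      γ _           = inj₂ (β , refl)
  <lex-++-cases []      (_ ∷ _) γ _           = inj₁ []<∷
  <lex-++-cases (y ∷ β) (x ∷ α) γ (head< y<x) = inj₁ (head< y<x)
  <lex-++-cases (y ∷ β) (x ∷ α) γ (tail< p) with <lex-++-cases β α γ p
  ... | inj₁ β<α       = inj₁ (tail< β<α)
  ... | inj₂ (δ , β≡)  = inj₂ (δ , cong (y ∷_) β≡)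

  ≺-trans : {α β γ : Word σ} → α ≺ β → β ≺ γ → α ≺ γ
  ≺-trans = <lex-trans

  ≺-dec : (α β : Word σ) → Dec (α ≺ β)
  ≺-dec α β = <lex-dec (reverse α) (reverse β)

  ⊣⇒reverse-prefix : {α β : Word σ} → α ⊣ β → ∃[ δ ] reverse β ≡ reverse α ++ δ
  ⊣⇒reverse-prefix {α} (γ , refl) = reverse γ , reverse-++ γ α

  reverse-prefix⇒⊣ : {α β : Word σ} → ∃[ δ ] reverse β ≡ reverse α ++ δ → α ⊣ β
  reverse-prefix⇒⊣ {α} {β} (δ , rβ≡) = reverse δ , (begin
    reverse δ ++ α                     ≡⟨ cong (reverse δ ++_) (reverse-involutive α) ⟨
    reverse δ ++ reverse (reverse α)   ≡⟨ reverse-++ (reverse α) δ ⟨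
    reverse (reverse α ++ δ)           ≡⟨ cong reverse rβ≡ ⟨
    reverse (reverse β)                ≡⟨ reverse-involutive β ⟩
    β                                  ∎)
    where open ≡-Reasoning

  ⊣⇒⊀ : {α β : Word σ} → α ⊣ β → ¬ β ≺ α
  ⊣⇒⊀ {α} α⊣β β≺α with ⊣⇒reverse-prefix α⊣β
  ... | δ , rβ≡ = ++≮lex (reverse α) δ (subst (_<lex reverse α) rβ≡ β≺α)

  ≺-⊣-cases : {γ α β : Word σ} → γ ≺ β → α ⊣ β → γ ≺ α ⊎ α ⊣ γ
  ≺-⊣-cases {γ} {α} γ≺β α⊣β with ⊣⇒reverse-prefix α⊣β
  ... | δ , rβ≡ = map₂ reverse-prefix⇒⊣ (<lex-++-cases (reverse γ) (reverse α) δ (subst (reverse γ <lex_) rβ≡ γ≺β))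

  ⊣[]⇒≡[] : {α : Word σ} → α ⊣ [] → α ≡ []
  ⊣[]⇒≡[] (γ , γα≡[]) = ++-conicalʳ γ _ γα≡[]

  ⊣-++ʳ : {α β : Word σ} (ρ : Word σ) → α ⊣ β → (α ++ ρ) ⊣ (β ++ ρ)
  ⊣-++ʳ {α} ρ (γ , refl) = γ , sym (++-assoc γ α ρ)

  ⊣-++-cases : {α β ρ : Word σ} → α ⊣ (β ++ ρ) → α ⊣ ρ ⊎ ∃[ μ ] (μ ≢ [] × μ ++ ρ ≡ α × μ ⊣ β)
  ⊣-++-cases {β = []}     α⊣ρ               = inj₁ α⊣ρ
  ⊣-++-cases {β = y ∷ β}  ([] , refl)       = inj₂ (y ∷ β , (λ ()) , refl , ([] , refl))
  ⊣-++-cases {β = y ∷ β}  (x ∷ γ , γα≡βρ) with ∷-injective γα≡βρ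
  ... | refl , γα≡βρ′ = map₂ (λ (μ , μ≢[] , μρ≡α , (δ , δμ≡β)) → μ , μ≢[] , μρ≡α , (x ∷ δ , cong (x ∷_) δμ≡β))
                                      (⊣-++-cases (γ , γα≡βρ′))

  take-length-++ : (μ ρ : Word σ) → take (length μ) (μ ++ ρ) ≡ μ
  take-length-++ []      ρ = refl
  take-length-++ (x ∷ μ) ρ = cong (x ∷_) (take-length-++ μ ρ)

  drop-length-++ : (μ ρ : Word σ) → drop (length μ) (μ ++ ρ) ≡ ρ
  drop-length-++ []      ρ = refl
  drop-length-++ (x ∷ μ) ρ = drop-length-++ μ ρ

  pre-suf-++ : {μ ρ α : Word σ} → μ ++ ρ ≡ α → pre α (length α ∸ length ρ) ≡ μ × suf α (length ρ) ≡ ρ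
  pre-suf-++ {μ} {ρ} refl rewrite length-++ μ {ρ} | m+n∸n≡m (length μ) (length ρ) =
    take-length-++ μ ρ , drop-length-++ μ ρ

  length-<-++ : {μ : Word σ} (ρ : Word σ) → μ ≢ [] → length ρ < length (μ ++ ρ)
  length-<-++ {[]}    ρ μ≢[] = contradiction refl μ≢[]
  length-<-++ {_ ∷ μ} ρ _    = s≤s (length-++-≤ʳ ρ {μ})

module _ {σ n : ℕ} (A : GNFA σ n) where
  open GNFA A

  I-Reach : ∀ {u w β} → I A u β → Reach A u w → ∃[ β′ ] I A w β′
  I-Reach u∈ here          = _ , u∈
  I-Reach u∈ (step e u⇝w) = I-Reach (next u∈ e) u⇝w

  I-nonempty : IsGNFA A → ∀ u → ∃[ β ] I A u β
  I-nonempty (_ , reachable , _) u = I-Reach start (reachable u)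

  EpsWalk-snoc : ∀ {x u v} → EpsWalk A x u → (u , v , []) ∈L E → EpsWalk A x v
  EpsWalk-snoc done         e = more e done
  EpsWalk-snoc (more e′ x⇝u) e = more e′ (EpsWalk-snoc x⇝u e)

  EpsWalk-I : ∀ {x y β} → EpsWalk A x y → I A x β → I A y β
  EpsWalk-I               done         x∈ = x∈
  EpsWalk-I {x} {y} {β} (more e x⇝y) x∈ = EpsWalk-I x⇝y (subst (I A _) (++-identityʳ β) (next x∈ e))

  Gsuf⇒¬Gprec : ∀ {α u} → Gsuf A α u → ¬ Gprec A α u
  Gsuf⇒¬Gprec (β , u∈ , α⊣β) u∈≺ = ⊣⇒⊀ α⊣β (u∈≺ β u∈)

  Gsuf-step : ∀ {α u′ u ρ} → (u′ , u , ρ) ∈L E → Gsuf A α u′ → Gsuf A (α ++ ρ) u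
  Gsuf-step {ρ = ρ} e (β , u′∈ , α⊣β) = β ++ ρ , next u′∈ e , ⊣-++ʳ ρ α⊣β

  Gstar⇒Gsuf : (∀ u → ∃[ β ] I A u β) → ∀ {α u} → Gstar A α u → Gsuf A α u
  Gstar⇒Gsuf nonempty {α} (u′ , ρ , e , (γ , γα≡ρ)) =
    let β , u′∈ = nonempty u′ in β ++ ρ , next u′∈ e , (β ++ γ , trans (++-assoc β γ α) (cong (β ++_) γα≡ρ))

  EnteredStraddling : ℕ → Word σ → Fin n → Set
  EnteredStraddling r α x =
    ∃[ k ] ∃[ u′ ] (0 < k × k < suc r ⊓ length α × (u′ , x , suf α k) ∈L E × Gsuf A (pre α (length α ∸ k)) u′)

  Gsuf-origin : ∀ {r α y β} → IsRGNFA A r → α ≢ [] → I A y β → α ⊣ β →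
                ∃[ x ] (EpsWalk A x y × Gsuf A α x × (Gstar A α x ⊎ EnteredStraddling r α x))
  Gsuf-origin _ α≢[] start α⊣[] = contradiction (⊣[]⇒≡[] α⊣[]) α≢[]
  Gsuf-origin {α = α} rg α≢[] (next {β = β} {ρ = []} u′∈ e) α⊣β =
    let x , x⇝u′ , x∈ , kind = Gsuf-origin rg α≢[] u′∈ (subst (α ⊣_) (++-identityʳ β) α⊣β)
    in x , EpsWalk-snoc x⇝u′ e , x∈ , kind
  Gsuf-origin {α = α} {y} rg α≢[] (next {u′} {β = β} {ρ = ρ@(_ ∷ _)} u′∈ e) α⊣βρ =
    y , done , (β ++ ρ , next u′∈ e , α⊣βρ) , [ entered-inside , entered-straddling ] (⊣-++-cases α⊣βρ)
    where
      entered-inside : α ⊣ ρ → Gstar A α y ⊎ EnteredStraddling _ α y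
      entered-inside α⊣ρ = inj₁ (u′ , ρ , e , α⊣ρ)
      entered-straddling : ∃[ μ ] (μ ≢ [] × μ ++ ρ ≡ α × μ ⊣ β) → Gstar A α y ⊎ EnteredStraddling _ α y
      entered-straddling (μ , μ≢[] , μρ≡α , μ⊣β) =
        inj₂ (length ρ , u′ , s≤s z≤n , ⊓-glb (s≤s (All.lookup rg e)) ρ<α ,
              subst (λ τ → (u′ , y , τ) ∈L E) (sym suf≡ρ) e , (β , u′∈ , subst (_⊣ β) (sym pre≡μ) μ⊣β))
        where
          pre≡μ : pre α (length α ∸ length ρ) ≡ μ
          pre≡μ = proj₁ (pre-suf-++ μρ≡α)
          suf≡ρ : suf α (length ρ) ≡ ρ
          suf≡ρ = proj₂ (pre-suf-++ μρ≡α)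
          ρ<α : length ρ < length α
          ρ<α = subst (length ρ <_) (cong length μρ≡α) (length-<-++ ρ μ≢[])

module _ {σ n : ℕ} (A : GNFA σ n) (ord : Fin n ↔ Fin n) where
  open GNFA A
  open Ordered A ord

  out-mono : ∀ {j j′} ρ → j ≤ j′ → out j ρ ≤ out j′ ρ
  out-mono ρ j≤j′ = filter-length-mono _ _ E λ { (_ , _ , _) _ (u′≤j , refl) → ≤-trans u′≤j j≤j′ , refl }

  out-mono-< : ∀ {j j′ u′ u ρ} → j ≤ j′ → (u′ , u , ρ) ∈L E → ¬ rank u′ ≤ j → rank u′ ≤ j′ →
               out j ρ < out j′ ρ
  out-mono-< j≤j′ e u′≰j u′≤j′ =
    filter-length-mono-< _ _ E (λ { (_ , _ , _) _ (v′≤j , refl) → ≤-trans v′≤j j≤j′ , refl })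
                         e (u′≤j′ , refl) (u′≰j ∘ proj₁)

  out<out⇒edge : ∀ {j j′ ρ} → out j ρ < out j′ ρ → ∃[ u′ ] ∃[ u ] ((u′ , u , ρ) ∈L E × ¬ rank u′ ≤ j × rank u′ ≤ j′)
  out<out⇒edge lt with filter-length-<⇒∃ _ _ E lt
  ... | (u′ , u , _) , e , (u′≤j′ , refl) , ¬counted = u′ , u , e , (λ u′≤j → ¬counted (u′≤j , refl)) , u′≤j′

  out≤inn : ∀ {j j′ ρ} → (∀ {u′ u} → (u′ , u , ρ) ∈L E → rank u′ ≤ j → rank u ≤ j′) → out j ρ ≤ inn j′ ρ
  out≤inn src⇒tgt = filter-length-mono _ _ E λ { (_ , _ , _) e (u′≤j , refl) → src⇒tgt e u′≤j , refl }

  inn<out : ∀ {j j′ u′ u ρ} → (∀ {v′ v} → (v′ , v , ρ) ∈L E → rank v ≤ j′ → rank v′ ≤ j) →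
            (u′ , u , ρ) ∈L E → rank u′ ≤ j → ¬ rank u ≤ j′ → inn j′ ρ < out j ρ
  inn<out tgt⇒src e u′≤j u≰j′ =
    filter-length-mono-< _ _ E (λ { (_ , _ , _) e′ (v≤j′ , refl) → tgt⇒src e′ v≤j′ , refl })
                         e (u′≤j , refl) (u≰j′ ∘ proj₁)

module _ {σ n : ℕ} (A : GNFA σ n) (ord : Fin n ↔ Fin n)
         (≤Q⇒⪯A : ∀ u v → Ordered._≤Q_ A ord u v → _⪯A_ A u v)
         (nonempty : ∀ u → ∃[ β ] I A u β) where
  open Ordered A ord

  Gprec-downward : ∀ {α u v} → u ≤Q v → Gprec A α v → Gprec A α u
  Gprec-downward {α} {u} {v} u≤v v∈≺ γ u∈ with ≺-dec γ α | nonempty v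
  ... | yes γ≺α | _      = γ≺α
  ... | no  γ⊀α | β , v∈ = contradiction (≺-trans {_} {γ} {β} {α} γ≺β (v∈≺ β v∈)) γ⊀α
    where
      γ≺β : γ ≺ β
      γ≺β = ≤Q⇒⪯A u v u≤v γ β u∈ v∈ (λ ((_ , γ∈Iv) , _) → γ⊀α (v∈≺ γ γ∈Iv))

  GprecSuf-downward : ∀ {α u v} → u ≤Q v → GprecSuf A α v → ¬ ¬ GprecSuf A α u
  GprecSuf-downward {α} u≤v (inj₁ v∈≺) u∉ = u∉ (inj₁ (Gprec-downward {α} u≤v v∈≺))
  GprecSuf-downward {α} {u} {v} u≤v (inj₂ (β , v∈ , α⊣β)) u∉ = u∉ (inj₁ u∈≺)
    where
      u∈≺ : Gprec A α u
      u∈≺ γ u∈ = [ id , (λ α⊣γ → contradiction (inj₂ (γ , u∈ , α⊣γ)) u∉) ]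
                   (≺-⊣-cases (≤Q⇒⪯A u v u≤v γ β u∈ v∈ (λ (_ , β∈Iu , _) → u∉ (inj₂ (β , β∈Iu , α⊣β)))) α⊣β)

  ε-ancestor∉GprecSuf : ∀ {α x y z} → z ≤Q y → Gsuf A α z → ¬ Gsuf A α y → EpsWalk A x y → ¬ GprecSuf A α x
  ε-ancestor∉GprecSuf z≤y z∈ y∉ x⇝y (inj₂ (β , x∈ , α⊣β)) = y∉ (β , EpsWalk-I A x⇝y x∈ , α⊣β)
  ε-ancestor∉GprecSuf {α} {x} {y} {z} z≤y (γ , z∈ , α⊣γ) y∉ x⇝y (inj₁ x∈≺) with nonempty x
  ... | β , x∈ = ⊣⇒⊀ α⊣γ (≺-trans {_} {γ} {β} {α} γ≺β (x∈≺ β x∈))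
    where
      γ≺β : γ ≺ β
      γ≺β = ≤Q⇒⪯A z y z≤y γ β z∈ (EpsWalk-I A x⇝y x∈) (λ ((_ , γ∈Iy) , _) → y∉ (γ , γ∈Iy , α⊣γ))

module GprecSufSize {σ n : ℕ} (A : GNFA σ n) (gn : IsGNFA A) (r : ℕ) (rg : IsRGNFA A r)
  (ord : Fin n ↔ Fin n) (W : Ordered.IsWheelerOrder A ord) (α : Word σ) (α≢[] : α ≢ [])
  (Sp Sd : ℕ → Subset n) (Sp-rep : ∀ m → Represents (Sp m) (Gprec A (pre α m)))
  (Sd-rep : ∀ m → Represents (Sd m) (GprecSuf A (pre α m))) where
  open GNFA A
  open Ordered A ord

  L : ℕ
  L = length α

  f g : ℕ → ℕ
  f k = out ∣ Sp (L ∸ k) ∣ (suf α k)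
  g k = out ∣ Sd (L ∸ k) ∣ (suf α k)

  a d : ℕ
  a = ∣ Sp L ∣
  d = ∣ Sd L ∣

  ≤Q⇒⪯A : ∀ u v → u ≤Q v → _⪯A_ A u v
  ≤Q⇒⪯A = proj₁ W

  sources-monotone : ∀ {u′ u v′ v ρ} → (u′ , u , ρ) ∈L E → (v′ , v , ρ) ∈L E → u <Q v → u′ ≤Q v′
  sources-monotone = proj₂ (proj₂ (proj₂ W)) _ _ _ _ _

  nonempty : ∀ u → ∃[ β ] I A u β
  nonempty = I-nonempty A gn

  Gprec⇔ : ∀ m u → Gprec A (pre α m) u ⇔ rank u ≤ ∣ Sp m ∣
  Gprec⇔ m = represented⇔position≤∣∣ ord (Sp m) (Sp-rep m)
               (λ u≤v v∈ → contradiction (Gprec-downward A ord ≤Q⇒⪯A nonempty {pre α m} u≤v v∈))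

  GprecSuf⇔ : ∀ m u → GprecSuf A (pre α m) u ⇔ rank u ≤ ∣ Sd m ∣
  GprecSuf⇔ m = represented⇔position≤∣∣ ord (Sd m) (Sd-rep m)
                  (GprecSuf-downward A ord ≤Q⇒⪯A nonempty {pre α m})

  pre-α-L : pre α L ≡ α
  pre-α-L = take-all L α ≤-refl

  Gprec-α⇔ : ∀ u → Gprec A α u ⇔ rank u ≤ a
  Gprec-α⇔ = subst (λ w → ∀ u → Gprec A w u ⇔ rank u ≤ a) pre-α-L (Gprec⇔ L)

  GprecSuf-α⇔ : ∀ u → GprecSuf A α u ⇔ rank u ≤ d
  GprecSuf-α⇔ = subst (λ w → ∀ u → GprecSuf A w u ⇔ rank u ≤ d) pre-α-L (GprecSuf⇔ L)

  ∣Sp∣≤∣Sd∣ : ∀ m → ∣ Sp m ∣ ≤ ∣ Sd m ∣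
  ∣Sp∣≤∣Sd∣ m = p⊆q⇒∣p∣≤∣q∣ λ {u} u∈ → proj₂ (Sd-rep m u) (inj₁ (proj₁ (Sp-rep m u) u∈))

  a≤d : a ≤ d
  a≤d = ∣Sp∣≤∣Sd∣ L

  f≤g : ∀ k → 0 < k → k < suc r ⊓ L → f k ≤ g k
  f≤g k _ _ = out-mono A ord (suf α k) (∣Sp∣≤∣Sd∣ (L ∸ k))

  Gsuf⇒≰∣Sp∣ : ∀ m u → Gsuf A (pre α m) u → ¬ rank u ≤ ∣ Sp m ∣
  Gsuf⇒≰∣Sp∣ m u u∈ = Gsuf⇒¬Gprec A u∈ ∘ from (Gprec⇔ m u)

  Gsuf⇒≤∣Sd∣ : ∀ m u → Gsuf A (pre α m) u → rank u ≤ ∣ Sd m ∣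
  Gsuf⇒≤∣Sd∣ m u = to (GprecSuf⇔ m u) ∘ inj₂

  between⇒Gsuf : ∀ m u → ¬ rank u ≤ ∣ Sp m ∣ → rank u ≤ ∣ Sd m ∣ → Gsuf A (pre α m) u
  between⇒Gsuf m u u≰∣Sp∣ u≤∣Sd∣ =
    [ (λ u∈ → contradiction (to (Gprec⇔ m u) u∈) u≰∣Sp∣) , id ] (from (GprecSuf⇔ m u) u≤∣Sd∣)

  between⇒Gsuf-α : ∀ u → ¬ rank u ≤ a → rank u ≤ d → Gsuf A α u
  between⇒Gsuf-α u u≰a u≤d = subst (λ w → Gsuf A w u) pre-α-L (between⇒Gsuf L u u≰a u≤d)

  Gsuf-α⇒≤d : ∀ {u} → Gsuf A α u → rank u ≤ d
  Gsuf-α⇒≤d {u} = to (GprecSuf-α⇔ u) ∘ inj₂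

  Gsuf-α⇒≰a : ∀ {u} → Gsuf A α u → ¬ rank u ≤ a
  Gsuf-α⇒≰a {u} u∈ = Gsuf⇒¬Gprec A u∈ ∘ from (Gprec-α⇔ u)

  Gsuf-α-at : ∀ {t} → a ≤ t → t < d → ∃[ u ] (rank u ≡ suc t × Gsuf A α u)
  Gsuf-α-at {t} a≤t t<d with position-onto ord (<-≤-trans t<d (∣p∣≤n (Sd L)))
  ... | u , u≡ = u , u≡ , between⇒Gsuf-α u (<⇒≱ (subst (a <_) (sym u≡) (s≤s a≤t))) (subst (_≤ d) (sym u≡) t<d)

  straddling-target≤d : ∀ k {u′ u} → (u′ , u , suf α k) ∈L E →
                        ¬ rank u′ ≤ ∣ Sp (L ∸ k) ∣ → rank u′ ≤ ∣ Sd (L ∸ k) ∣ → rank u ≤ d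
  straddling-target≤d k {u′} {u} e u′≰ u′≤ =
    Gsuf-α⇒≤d (subst (λ w → Gsuf A w u) (take++drop≡id (L ∸ k) α) (Gsuf-step A e (between⇒Gsuf (L ∸ k) u′ u′≰ u′≤)))

  GstarAt : ℕ → Set
  GstarAt i = i ≤ n × (1 ≤ i → At i (Gstar A α))

  Covers : ℕ → Set
  Covers j = j ≤ n × (∀ k → 0 < k → k < suc r ⊓ L → f k < g k → g k ≤ inn j (suf α k))

  GstarAt⇒≤d : ∀ i → GstarAt i → i ≤ d
  GstarAt⇒≤d zero    _          = z≤n
  GstarAt⇒≤d (suc i) (_ , at-i) =
    let u , u≡i , u∈ = at-i (s≤s z≤n) in subst (_≤ d) u≡i (Gsuf-α⇒≤d (Gstar⇒Gsuf A nonempty u∈))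

  -- Some edge counted in g k but not in f k leaves G_⊣(p(α,|α|-k)) for a state w ≤ d; by axiom (4)
  -- every other edge counted in g k either does the same or enters a state ≤ w.
  d-covers : ∀ k → f k < g k → g k ≤ inn d (suf α k)
  d-covers k f<g with out<out⇒edge A ord f<g
  ... | w′ , w , e-w , w′≰ , w′≤ = out≤inn A ord target≤d
    where
      target≤d : ∀ {u′ u} → (u′ , u , suf α k) ∈L E → rank u′ ≤ ∣ Sd (L ∸ k) ∣ → rank u ≤ d
      target≤d {u′} {u} e u′≤ with rank u′ ≤? ∣ Sp (L ∸ k) ∣
      ... | no  u′≰ = straddling-target≤d k e u′≰ u′≤
      ... | yes u′≤Sp with rank u ≤? rank w
      ...   | yes u≤w = ≤-trans u≤w (straddling-target≤d k e-w w′≰ w′≤)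
      ...   | no  u≰w = contradiction (≤-trans (sources-monotone e-w e (≰⇒> u≰w)) u′≤Sp) w′≰

  Covers-d : Covers d
  Covers-d = ∣p∣≤n (Sd L) , λ k _ _ → d-covers k

  Amin-fixed-at-d : a < d → d < n → AminIs (suc d) (suc d)
  Amin-fixed-at-d a<d d<n with position-onto ord d<n | Gsuf-α-at ≤-refl a<d
  ... | y , y≡ | z , z≡ , z∈ = (s≤s z≤n , d<n , y , y , y≡ , y≡ , done) , least
    where
      least : ∀ j → 1 ≤ j → j ≤ n → ∃[ x ] ∃[ y′ ] (rank x ≡ j × rank y′ ≡ suc d × EpsWalk A x y′) → suc d ≤ j
      least _ _ _ (x , y′ , refl , y′≡ , x⇝y′) with suc d ≤? rank x
      ... | yes d<x = d<x
      ... | no  d≮x = contradiction (from (GprecSuf-α⇔ x) (≮⇒≥ d≮x))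
                        (ε-ancestor∉GprecSuf A ord ≤Q⇒⪯A nonempty z≤y′ z∈ y′∉ x⇝y′)
        where
          z≤y′ : z ≤Q y′
          z≤y′ = subst₂ _≤_ (sym z≡) (sym y′≡) (m≤n⇒m≤1+n a<d)
          y′∉ : ¬ Gsuf A α y′
          y′∉ = 1+n≰n ∘ subst (_≤ d) y′≡ ∘ Gsuf-α⇒≤d

  module Bounds (hb hc : ℕ) (HB : IsLargest GstarAt hb) (HC : IsSmallest Covers hc) where

    h : ℕ
    h = a ⊔ hb ⊔ hc

    a≤h : a ≤ h
    a≤h = ≤-trans (m≤m⊔n a hb) (m≤m⊔n (a ⊔ hb) hc)

    h≤d : h ≤ d
    h≤d = ⊔-lub (⊔-lub a≤d (GstarAt⇒≤d hb (proj₁ HB))) (proj₂ HC d Covers-d)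

    Gstar⇒≤hb : ∀ {x} → Gstar A α x → rank x ≤ hb
    Gstar⇒≤hb {x} x∈ = proj₂ HB (rank x) (position≤n ord x , λ _ → x , refl , x∈)

    -- If x > hc, the edge into x is counted in g k but not in in(Q[1,hc], s(α,k)), while by axiom (4)
    -- every edge counted there is counted in g k.
    EnteredStraddling⇒≤hc : ∀ {x} → EnteredStraddling A r α x → rank x ≤ hc
    EnteredStraddling⇒≤hc {x} (k , u′ , 0<k , k<r⊓L , e , u′∈) with rank x ≤? hc
    ... | yes x≤hc = x≤hc
    ... | no  x≰hc = contradiction (proj₂ (proj₁ HC) k 0<k k<r⊓L f<g) (<⇒≱ inn<g)
      where
        u′≤ : rank u′ ≤ ∣ Sd (L ∸ k) ∣
        u′≤ = Gsuf⇒≤∣Sd∣ (L ∸ k) u′ u′∈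
        f<g : f k < g k
        f<g = out-mono-< A ord (∣Sp∣≤∣Sd∣ (L ∸ k)) e (Gsuf⇒≰∣Sp∣ (L ∸ k) u′ u′∈) u′≤
        inn<g : inn hc (suf α k) < g k
        inn<g = inn<out A ord (λ e′ v≤hc → ≤-trans (sources-monotone e′ e (≤-<-trans v≤hc (≰⇒> x≰hc))) u′≤) e u′≤ x≰hc

    Gsuf-α-origin≤h : ∀ {y} → Gsuf A α y → ∃[ x ] (EpsWalk A x y × Gsuf A α x × rank x ≤ h)
    Gsuf-α-origin≤h (β , y∈ , α⊣β) with Gsuf-origin A rg α≢[] y∈ α⊣β
    ... | x , x⇝y , x∈ , inj₁ star = x , x⇝y , x∈ , ≤-trans (Gstar⇒≤hb star) (≤-trans (m≤n⊔m a hb) (m≤m⊔n _ hc))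
    ... | x , x⇝y , x∈ , inj₂ str  = x , x⇝y , x∈ , ≤-trans (EnteredStraddling⇒≤hc str) (m≤n⊔m _ hc)

    a<d⇒a<h : a < d → a < h
    a<d⇒a<h a<d with Gsuf-α-at ≤-refl a<d
    ... | _ , _ , z∈ with Gsuf-α-origin≤h z∈
    ...   | x , _ , x∈ , x≤h = <-≤-trans (≰⇒> (Gsuf-α⇒≰a x∈)) x≤h

    h≡a⇒d≡a : h ≡ a → d ≡ a
    h≡a⇒d≡a h≡a = ≤-antisym (≮⇒≥ (<-irrefl (sym h≡a) ∘ a<d⇒a<h)) a≤d

    Amin-not-fixed : ∀ {t} → a < h → h ≤ t → t < d → ¬ AminIs (suc t) (suc t)
    Amin-not-fixed a<h h≤t t<d fixed with Gsuf-α-at (≤-trans (<⇒≤ a<h) h≤t) t<d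
    ... | y , y≡ , y∈ with Gsuf-α-origin≤h y∈
    ...   | x , x⇝y , _ , x≤h =
      <⇒≱ (proj₂ fixed (rank x) (s≤s z≤n) (position≤n ord x) (x , y , refl , y≡ , x⇝y)) (≤-trans x≤h h≤t)

    d-least : a < h → ∀ t → h ≤ t → (t < n → AminIs (suc t) (suc t)) → d ≤ t
    d-least a<h t h≤t fixed = ≮⇒≥ λ t<d → Amin-not-fixed a<h h≤t t<d (fixed (<-≤-trans t<d (∣p∣≤n (Sd L))))

    d-smallest : a < h → IsSmallest (λ t → h ≤ t × t ≤ n × (t < n → AminIs (suc t) (suc t))) d
    d-smallest a<h = (h≤d , ∣p∣≤n (Sd L) , Amin-fixed-at-d (<-≤-trans a<h h≤d)) ,
                     λ t (h≤t , _ , fixed) → d-least a<h t h≤t fixed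

lemma5 : (σ n : ℕ) (A : GNFA σ n) → IsGNFA A →
         (r : ℕ) → IsRGNFA A r →
         (ord : Fin n ↔ Fin n) → Ordered.IsWheelerOrder A ord →
         (α : Word σ) → α ≢ [] →
         (Sp Sd : ℕ → Subset n) →
         (∀ m → Represents (Sp m) (Gprec A (pre α m))) →
         (∀ m → Represents (Sd m) (GprecSuf A (pre α m))) →
         let open Ordered A ord
             L = length α
             f = λ k → out ∣ Sp (L ∸ k) ∣ (suf α k)
             g = λ k → out ∣ Sd (L ∸ k) ∣ (suf α k)
             a = ∣ Sp L ∣
             d = ∣ Sd L ∣
         in (∀ k → 0 < k → k < suc r ⊓ L → f k ≤ g k)
            × (∀ hb hc →
               IsLargest (λ i → i ≤ n × (1 ≤ i → At i (Gstar A α))) hb →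
               IsSmallest (λ j → j ≤ n × (∀ k → 0 < k → k < suc r ⊓ L →
                                  f k < g k → g k ≤ inn j (suf α k))) hc →
               let h = a ⊔ hb ⊔ hc
               in a ≤ h
                  × (h ≡ a → d ≡ h × h ≡ a)
                  × (a < h → (h ≤ d × a < h)
                            × IsSmallest (λ t → h ≤ t × t ≤ n ×
                                             (t < n → AminIs (suc t) (suc t))) d))
lemma5 σ n A gn r rg ord W α α≢[] Sp Sd Sp-rep Sd-rep =
  f≤g , λ hb hc HB HC → let open Bounds hb hc HB HC in
    a≤h , (λ h≡a → trans (h≡a⇒d≡a h≡a) (sym h≡a) , h≡a) , (λ a<h → (h≤d , a<h) , d-smallest a<h)
  where open GprecSufSize A gn r rg ord W α α≢[] Sp Sd Sp-rep Sd-rep
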